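{- Completeness of the modal algebraic semantics implies completeness of the modal stable semantics. That is: if every formula valid in all algebraic models is provable, then every formula valid in all modal stable models is provable.
   Context: We consider the intuitionistic modal logic (of Dzik et al.) with two modalities, written ◆ (a filled/black diamond) and □, intended to be adjoint (◆ ⊣ □). Its algebraic models are Heyting algebras H equipped with two operators ◆, □ : H → H forming an adjunction ◆ ⊣ □ (i.e. ◆x ≤ y iff x ≤ □y). A stable frame is a distributive lattice (W, ⊑) with bottom 0 and top 1. A stable bimodule on W is a relation R ⊆ W × W such that w' ⊑ w R v ⊑ v' implies w' R v', and additionally: (i) w R v₁ and w R v₂ imply w R (v₁ ∧ v₂); (ii) w R 1; (iii) (w₁ ∧ w₂) R v implies there exist v₁, v₂ with v₁ ∧ v₂ ⊑ v, w₁ R v₁ and w₂ R v₂; (iv) 1 R v iff v = 1. A modal stable model (W, ⊑, R, V) consists of a stable frame, a stable bimodule R, and a valuation V assigning to each propositional variable a filter of W (a non-empty upper subset closed under finite meets). Satisfaction w ⊩ φ is defined as in Kripke semantics for atoms (w ∈ V(p)), ⊤, ∧ and → (w ⊩ φ → ψ iff for all v ⊒ w, v ⊩ φ implies v ⊩ ψ), while w ⊩ ⊥ iff w = 1; w ⊩ φ ∨ ψ iff there exist v₁, v₂ with v₁ ∧ v₂ ⊑ w, v₁ ⊩ φ and v₂ ⊩ ψ; w ⊩ ◆φ iff there exists v with v R w and v ⊩ φ; w ⊩ □φ iff for all v, w R v implies v ⊩ φ. A formula is valid in the stable semantics if it holds at every world of every modal stable model. -}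

module Defs where

open import Level using (Level; _⊔_; suc)
open import Data.Nat using (ℕ)
import Data.Unit as Unit
open import Data.Product using (Σ; _×_; ∃; ∃-syntax; _,_)
open import Function using (_⇔_)
open import Relation.Binary.Definitions using (Minimum; Maximum)
open import Relation.Binary.Lattice.Bundles using (HeytingAlgebra; DistributiveLattice)

infixr 4 _⇒_
infixr 5 _∨ᶠ_
infixr 6 _∧ᶠ_

data Form : Set where
  var  : ℕ → Form
  ⊤ᶠ   : Form
  ⊥ᶠ   : Form
  _∧ᶠ_ : Form → Form → Form
  _∨ᶠ_ : Form → Form → Form
  _⇒_  : Form → Form → Form
  ◆_   : Form → Form
  □_   : Form → Form

-- Proof system (Hilbert style): intuitionistic propositional logic
-- (axiom schemes + modus ponens) extended, as in Dzik–Järvinen–Kondo's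
-- logic with Galois-connected modalities, by the unit/counit axioms of
-- the adjunction ◆ ⊣ □ and the monotonicity rules for ◆ and □.

data ⊢_ : Form → Set where
  ax-K   : ∀ {φ ψ} → ⊢ (φ ⇒ ψ ⇒ φ)
  ax-S   : ∀ {φ ψ χ} → ⊢ ((φ ⇒ ψ ⇒ χ) ⇒ (φ ⇒ ψ) ⇒ φ ⇒ χ)
  ax-∧I  : ∀ {φ ψ} → ⊢ (φ ⇒ ψ ⇒ φ ∧ᶠ ψ)
  ax-∧E₁ : ∀ {φ ψ} → ⊢ (φ ∧ᶠ ψ ⇒ φ)
  ax-∧E₂ : ∀ {φ ψ} → ⊢ (φ ∧ᶠ ψ ⇒ ψ)
  ax-∨I₁ : ∀ {φ ψ} → ⊢ (φ ⇒ φ ∨ᶠ ψ)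
  ax-∨I₂ : ∀ {φ ψ} → ⊢ (ψ ⇒ φ ∨ᶠ ψ)
  ax-∨E  : ∀ {φ ψ χ} → ⊢ ((φ ⇒ χ) ⇒ (ψ ⇒ χ) ⇒ φ ∨ᶠ ψ ⇒ χ)
  ax-⊥E  : ∀ {φ} → ⊢ (⊥ᶠ ⇒ φ)
  ax-⊤I  : ⊢ ⊤ᶠ
  ax-unit   : ∀ {φ} → ⊢ (φ ⇒ □ (◆ φ))
  ax-counit : ∀ {φ} → ⊢ (◆ (□ φ) ⇒ φ)
  mp     : ∀ {φ ψ} → ⊢ (φ ⇒ ψ) → ⊢ φ → ⊢ ψ
  mono-◆ : ∀ {φ ψ} → ⊢ (φ ⇒ ψ) → ⊢ (◆ φ ⇒ ◆ ψ)
  mono-□ : ∀ {φ ψ} → ⊢ (φ ⇒ ψ) → ⊢ (□ φ ⇒ □ ψ)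

record ModalAlgebra (c ℓ₁ ℓ₂ : Level) : Set (suc (c ⊔ ℓ₁ ⊔ ℓ₂)) where
  field
    heyting : HeytingAlgebra c ℓ₁ ℓ₂
  open HeytingAlgebra heyting public
  field
    ◆ₐ : Carrier → Carrier
    □ₐ : Carrier → Carrier
    adjoint : ∀ x y → (◆ₐ x ≤ y) ⇔ (x ≤ □ₐ y)

module _ {c ℓ₁ ℓ₂} (A : ModalAlgebra c ℓ₁ ℓ₂) where
  open ModalAlgebra A

  ⟦_⟧ : Form → (ℕ → Carrier) → Carrier
  ⟦ var p ⟧ ρ = ρ p
  ⟦ ⊤ᶠ ⟧ ρ = ⊤
  ⟦ ⊥ᶠ ⟧ ρ = ⊥
  ⟦ φ ∧ᶠ ψ ⟧ ρ = ⟦ φ ⟧ ρ ∧ ⟦ ψ ⟧ ρ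
  ⟦ φ ∨ᶠ ψ ⟧ ρ = ⟦ φ ⟧ ρ ∨ ⟦ ψ ⟧ ρ
  ⟦ φ ⇒ ψ ⟧ ρ = ⟦ φ ⟧ ρ ⇨ ⟦ ψ ⟧ ρ
  ⟦ ◆ φ ⟧ ρ = ◆ₐ (⟦ φ ⟧ ρ)
  ⟦ □ φ ⟧ ρ = □ₐ (⟦ φ ⟧ ρ)

  AlgValidIn : Form → Set (c ⊔ ℓ₁)
  AlgValidIn φ = (ρ : ℕ → Carrier) → ⟦ φ ⟧ ρ ≈ ⊤

AlgValid : (c ℓ₁ ℓ₂ : Level) → Form → Set (suc (c ⊔ ℓ₁ ⊔ ℓ₂))
AlgValid c ℓ₁ ℓ₂ φ = (A : ModalAlgebra c ℓ₁ ℓ₂) → AlgValidIn A φ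

record StableFrame (c ℓ₁ ℓ₂ : Level) : Set (suc (c ⊔ ℓ₁ ⊔ ℓ₂)) where
  field
    distLattice : DistributiveLattice c ℓ₁ ℓ₂
  open DistributiveLattice distLattice public
  field
    𝟘 : Carrier
    𝟙 : Carrier
    𝟘-min : Minimum _≤_ 𝟘
    𝟙-max : Maximum _≤_ 𝟙

record StableBimodule {c ℓ₁ ℓ₂} (F : StableFrame c ℓ₁ ℓ₂) : Set (suc (c ⊔ ℓ₁ ⊔ ℓ₂)) where
  open StableFrame F
  field
    R : Carrier → Carrier → Set (c ⊔ ℓ₁ ⊔ ℓ₂)
    bimod : ∀ {w' w v v'} → w' ≤ w → R w v → v ≤ v' → R w' v'
    R-∧   : ∀ {w v₁ v₂} → R w v₁ → R w v₂ → R w (v₁ ∧ v₂)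
    R-𝟙   : ∀ {w} → R w 𝟙
    R-split : ∀ {w₁ w₂ v} → R (w₁ ∧ w₂) v →
              ∃[ v₁ ] ∃[ v₂ ] ((v₁ ∧ v₂) ≤ v × R w₁ v₁ × R w₂ v₂)
    R-top : ∀ {v} → R 𝟙 v ⇔ (v ≈ 𝟙)

record Filter {c ℓ₁ ℓ₂} (F : StableFrame c ℓ₁ ℓ₂) : Set (suc (c ⊔ ℓ₁ ⊔ ℓ₂)) where
  open StableFrame F
  field
    mem      : Carrier → Set (c ⊔ ℓ₁ ⊔ ℓ₂)
    nonempty : ∃[ w ] mem w
    upward   : ∀ {w v} → w ≤ v → mem w → mem v
    meet     : ∀ {w v} → mem w → mem v → mem (w ∧ v)

record StableModel (c ℓ₁ ℓ₂ : Level) : Set (suc (c ⊔ ℓ₁ ⊔ ℓ₂)) where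
  field
    frame : StableFrame c ℓ₁ ℓ₂
    bimodule : StableBimodule frame
    V : ℕ → Filter frame
  open StableFrame frame public
  open StableBimodule bimodule public

module _ {c ℓ₁ ℓ₂} (M : StableModel c ℓ₁ ℓ₂) where
  open StableModel M

  infix 3 _⊩_
  _⊩_ : Carrier → Form → Set (c ⊔ ℓ₁ ⊔ ℓ₂)
  w ⊩ var p = Filter.mem (V p) w
  w ⊩ ⊤ᶠ = Level.Lift _ Unit.⊤
  w ⊩ ⊥ᶠ = Level.Lift (c ⊔ ℓ₂) (w ≈ 𝟙)
  w ⊩ φ ∧ᶠ ψ = (w ⊩ φ) × (w ⊩ ψ)
  w ⊩ φ ∨ᶠ ψ = ∃[ v₁ ] ∃[ v₂ ] ((v₁ ∧ v₂) ≤ w × (v₁ ⊩ φ) × (v₂ ⊩ ψ))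
  w ⊩ φ ⇒ ψ = ∀ v → w ≤ v → v ⊩ φ → v ⊩ ψ
  w ⊩ ◆ φ = ∃[ v ] (R v w × (v ⊩ φ))
  w ⊩ □ φ = ∀ v → R w v → v ⊩ φ

StableValid : (c ℓ₁ ℓ₂ : Level) → Form → Set (suc (c ⊔ ℓ₁ ⊔ ℓ₂))
StableValid c ℓ₁ ℓ₂ φ = (M : StableModel c ℓ₁ ℓ₂) → (w : StableModel.Carrier M) → _⊩_ M w φ

AlgCompleteness : (c ℓ₁ ℓ₂ : Level) → Set (suc (c ⊔ ℓ₁ ⊔ ℓ₂))
AlgCompleteness c ℓ₁ ℓ₂ = ∀ φ → AlgValid c ℓ₁ ℓ₂ φ → ⊢ φ

StableCompleteness : (c ℓ₁ ℓ₂ : Level) → Set (suc (c ⊔ ℓ₁ ⊔ ℓ₂))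
StableCompleteness c ℓ₁ ℓ₂ = ∀ φ → StableValid c ℓ₁ ℓ₂ φ → ⊢ φ

-- Every modal algebra A with valuation ρ yields a stable model on the order dual of A:
-- worlds are elements of A, w R v means v ≤ ◆ w, and p is valued by the principal
-- filter of ρ p. By induction on formulas, w ⊩ φ iff w ≤ ⟦ φ ⟧ ρ. Hence a formula that
-- is stably valid holds at the world ⊤, so it evaluates to ⊤ in every modal algebra,
-- and algebraic completeness makes it provable.
module Submission where

open import Defs
open import Level using (_⊔_; Lift; lift)
open import Data.Nat using (ℕ)
open import Data.Unit using (tt)
open import Data.Product using (_,_)
open import Function using (flip; mk⇔)
open import Function.Bundles using (module Equivalence)
open import Relation.Binary.Lattice.Bundles using (HeytingAlgebra; DistributiveLattice)
import Relation.Binary.Lattice.Properties.HeytingAlgebra as HeytingAlgebraProperties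
import Relation.Binary.Lattice.Properties.Lattice as LatticeProperties
import Relation.Binary.Lattice.Properties.JoinSemilattice as JoinSemilatticeProperties
import Relation.Binary.Lattice.Properties.DistributiveLattice as DistributiveLatticeProperties

dualDistributiveLattice : ∀ {c ℓ₁ ℓ₂} → DistributiveLattice c ℓ₁ ℓ₂ → DistributiveLattice c ℓ₁ ℓ₂
dualDistributiveLattice L = record
  { _≤_ = flip _≤_
  ; _∨_ = _∧_
  ; _∧_ = _∨_
  ; isDistributiveLattice = record
    { isLattice    = LatticeProperties.∧-∨-isLattice lattice
    ; ∧-distribˡ-∨ = DistributiveLatticeProperties.∨-distribˡ-∧ L
    }
  }
  where open DistributiveLattice L

dualStableFrame : ∀ {c ℓ₁ ℓ₂} → HeytingAlgebra c ℓ₁ ℓ₂ → StableFrame c ℓ₁ ℓ₂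
dualStableFrame H = record
  { distLattice = dualDistributiveLattice (HeytingAlgebraProperties.distributiveLattice H)
  ; 𝟘     = ⊤
  ; 𝟙     = ⊥
  ; 𝟘-min = maximum
  ; 𝟙-max = minimum
  }
  where open HeytingAlgebra H

principalFilter : ∀ {c ℓ₁ ℓ₂} (F : StableFrame c ℓ₁ ℓ₂) → StableFrame.Carrier F → Filter F
principalFilter {c} {ℓ₁} F x = record
  { mem      = λ w → Lift (c ⊔ ℓ₁) (x ≤ w)
  ; nonempty = x , lift refl
  ; upward   = λ w≤v (lift x≤w) → lift (trans x≤w w≤v)
  ; meet     = λ (lift x≤w) (lift x≤v) → lift (∧-greatest x≤w x≤v)
  }
  where open StableFrame F

module ModalAlgebraProperties {c ℓ₁ ℓ₂} (A : ModalAlgebra c ℓ₁ ℓ₂) where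
  open ModalAlgebra A

  ◆≤⇒≤□ : ∀ {x y} → ◆ₐ x ≤ y → x ≤ □ₐ y
  ◆≤⇒≤□ {x} {y} = Equivalence.to (adjoint x y)

  ≤□⇒◆≤ : ∀ {x y} → x ≤ □ₐ y → ◆ₐ x ≤ y
  ≤□⇒◆≤ {x} {y} = Equivalence.from (adjoint x y)

  ◆-mono : ∀ {x y} → x ≤ y → ◆ₐ x ≤ ◆ₐ y
  ◆-mono x≤y = ≤□⇒◆≤ (trans x≤y (◆≤⇒≤□ refl))

  ◆-∨-≤ : ∀ x y → ◆ₐ (x ∨ y) ≤ ◆ₐ x ∨ ◆ₐ y
  ◆-∨-≤ x y = ≤□⇒◆≤ (∨-least (◆≤⇒≤□ (x≤x∨y _ _)) (◆≤⇒≤□ (y≤x∨y _ _)))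

  ◆⊥≤⊥ : ◆ₐ ⊥ ≤ ⊥
  ◆⊥≤⊥ = ≤□⇒◆≤ (minimum _)

diamondBimodule : ∀ {c ℓ₁ ℓ₂} (A : ModalAlgebra c ℓ₁ ℓ₂) →
                  StableBimodule (dualStableFrame (ModalAlgebra.heyting A))
diamondBimodule {c} {ℓ₁} A = record
  { R       = λ w v → Lift (c ⊔ ℓ₁) (v ≤ ◆ₐ w)
  ; bimod   = λ w≤w' (lift v≤◆w) v'≤v → lift (trans v'≤v (trans v≤◆w (◆-mono w≤w')))
  ; R-∧     = λ (lift p) (lift q) → lift (∨-least p q)
  ; R-𝟙     = lift (minimum _)
  ; R-split = λ {w₁} {w₂} (lift p) → ◆ₐ w₁ , ◆ₐ w₂ , trans p (◆-∨-≤ w₁ w₂) , lift refl , lift refl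
  ; R-top   = mk⇔ (λ (lift p) → antisym (trans p ◆⊥≤⊥) (minimum _))
                  (λ v≈⊥ → lift (trans (reflexive v≈⊥) (minimum _)))
  }
  where
  open ModalAlgebra A
  open ModalAlgebraProperties A

canonicalModel : ∀ {c ℓ₁ ℓ₂} (A : ModalAlgebra c ℓ₁ ℓ₂) → (ℕ → ModalAlgebra.Carrier A) → StableModel c ℓ₁ ℓ₂
canonicalModel A ρ = record
  { frame    = dualStableFrame (ModalAlgebra.heyting A)
  ; bimodule = diamondBimodule A
  ; V        = λ p → principalFilter (dualStableFrame (ModalAlgebra.heyting A)) (ρ p)
  }

module TruthLemma {c ℓ₁ ℓ₂} (A : ModalAlgebra c ℓ₁ ℓ₂) (ρ : ℕ → ModalAlgebra.Carrier A) where
  open ModalAlgebra A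
  open ModalAlgebraProperties A
  open JoinSemilatticeProperties joinSemilattice using (∨-monotonic)

  infix 3 _⊩ᶜ_
  _⊩ᶜ_ : Carrier → Form → Set (c ⊔ ℓ₁ ⊔ ℓ₂)
  _⊩ᶜ_ = _⊩_ (canonicalModel A ρ)

  ⟦_⟧ᶜ : Form → Carrier
  ⟦ φ ⟧ᶜ = ⟦_⟧ A φ ρ

  ⊩⇒≤⟦⟧ : ∀ φ {w} → w ⊩ᶜ φ → w ≤ ⟦ φ ⟧ᶜ
  ≤⟦⟧⇒⊩ : ∀ φ {w} → w ≤ ⟦ φ ⟧ᶜ → w ⊩ᶜ φ

  ⊩⇒≤⟦⟧ (var p)  (lift w≤ρp) = w≤ρp
  ⊩⇒≤⟦⟧ ⊤ᶠ       _          = maximum _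
  ⊩⇒≤⟦⟧ ⊥ᶠ       (lift w≈⊥) = reflexive w≈⊥
  ⊩⇒≤⟦⟧ (φ ∧ᶠ ψ) (wφ , wψ)  = ∧-greatest (⊩⇒≤⟦⟧ φ wφ) (⊩⇒≤⟦⟧ ψ wψ)
  ⊩⇒≤⟦⟧ (φ ∨ᶠ ψ) (v₁ , v₂ , w≤v₁∨v₂ , v₁φ , v₂ψ) =
    trans w≤v₁∨v₂ (∨-monotonic (⊩⇒≤⟦⟧ φ v₁φ) (⊩⇒≤⟦⟧ ψ v₂ψ))
  ⊩⇒≤⟦⟧ (φ ⇒ ψ)  {w} wφ⇒ψ  =
    transpose-⇨ (⊩⇒≤⟦⟧ ψ (wφ⇒ψ (w ∧ ⟦ φ ⟧ᶜ) (x∧y≤x _ _) (≤⟦⟧⇒⊩ φ (x∧y≤y _ _))))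
  ⊩⇒≤⟦⟧ (◆ φ)    (v , lift w≤◆v , vφ) = trans w≤◆v (◆-mono (⊩⇒≤⟦⟧ φ vφ))
  ⊩⇒≤⟦⟧ (□ φ)    {w} w□φ  = ◆≤⇒≤□ (⊩⇒≤⟦⟧ φ (w□φ (◆ₐ w) (lift refl)))

  ≤⟦⟧⇒⊩ (var p)  w≤        = lift w≤
  ≤⟦⟧⇒⊩ ⊤ᶠ       _         = lift tt
  ≤⟦⟧⇒⊩ ⊥ᶠ       w≤⊥       = lift (antisym w≤⊥ (minimum _))
  ≤⟦⟧⇒⊩ (φ ∧ᶠ ψ) w≤        =
    ≤⟦⟧⇒⊩ φ (trans w≤ (x∧y≤x _ _)) , ≤⟦⟧⇒⊩ ψ (trans w≤ (x∧y≤y _ _))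
  ≤⟦⟧⇒⊩ (φ ∨ᶠ ψ) w≤        = ⟦ φ ⟧ᶜ , ⟦ ψ ⟧ᶜ , w≤ , ≤⟦⟧⇒⊩ φ refl , ≤⟦⟧⇒⊩ ψ refl
  ≤⟦⟧⇒⊩ (φ ⇒ ψ)  w≤ v v≤w vφ =
    ≤⟦⟧⇒⊩ ψ (trans (∧-greatest v≤w (⊩⇒≤⟦⟧ φ vφ)) (transpose-∧ w≤))
  ≤⟦⟧⇒⊩ (◆ φ)    w≤        = ⟦ φ ⟧ᶜ , lift w≤ , ≤⟦⟧⇒⊩ φ refl
  ≤⟦⟧⇒⊩ (□ φ)    w≤ v (lift v≤◆w) = ≤⟦⟧⇒⊩ φ (trans v≤◆w (≤□⇒◆≤ w≤))

stableValid⇒algValid : ∀ {c ℓ₁ ℓ₂} φ → StableValid c ℓ₁ ℓ₂ φ → AlgValid c ℓ₁ ℓ₂ φ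
stableValid⇒algValid φ valid A ρ = antisym (maximum _) (⊩⇒≤⟦⟧ φ (valid (canonicalModel A ρ) ⊤))
  where
  open ModalAlgebra A
  open TruthLemma A ρ

theorem4p3 : ∀ {c ℓ₁ ℓ₂} → AlgCompleteness c ℓ₁ ℓ₂ → StableCompleteness c ℓ₁ ℓ₂
theorem4p3 complete φ valid = complete φ (stableValid⇒algValid φ valid)
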